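{- Consider the algorithm $\mathcal A$ described in the context, run on a valid W$k$S-RSP input $(\sigma_1,\ell_1),\dots,(\sigma_T,\ell_T)$ with $\ell_1=k$. For every $t\in\{1,\dots,T\}$, every $\ell\in\{1,\dots,k\}$ and every $p^{\ell+1},\dots,p^k\in U$, conditioned on $s^i_t=p^i$ for all $i\in\{\ell+1,\dots,k\}$ and on $Q^\ell_t(p^{\ell+1},\dots,p^k)\ne\emptyset$, the point $s^\ell_t$ is uniformly distributed on $Q^\ell_t(p^{\ell+1},\dots,p^k)$.
   Context: $U$ is a finite set (uniform metric). A hierarchical service pattern over $[1,s+1)$ is a $k$-tuple $\mathcal I=(\mathcal I^1,\dots,\mathcal I^k)$ of partitions of $[1,s+1)$ into left-closed right-open integer intervals with $\mathcal I^\ell$ refining $\mathcal I^{\ell+1}$. A labeling maps the multiset $\mathcal I^1\uplus\dots\uplus\mathcal I^k$ to $U$; it is feasible with respect to $(\sigma_1,\dots,\sigma_s)$ if each $r\le s$ lies in some interval labeled $\sigma_r$. The $\ell$-extension of a pattern $\mathcal I_{t-1}$ over $[1,t)$ adds $[t,t+1)$ as a new interval to each level $i\le\ell$ and extends the last interval of each level $i>\ell$ by $[t,t+1)$. A valid W$k$S-RSP input is a sequence of pairs $(\sigma_t,\ell_t)\in U\times\{0,\dots,k\}$ such that, with $\mathcal I_t$ the $\ell_t$-extension of $\mathcal I_{t-1}$, each $\mathcal I_t$ is feasible with respect to $\rho_t=(\sigma_1,\dots,\sigma_t)$. $L^i_t$ is the last interval of $\mathcal I^i_t$. $Q^\ell_t(p^{\ell+1},\dots,p^k)$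 is the set of $p^\ell\in U$ such that some feasible labeling $\gamma$ of $\mathcal I_t$ w.r.t. $\rho_t$ has $\gamma(L^i_t)=p^i$ for all $i\in\{\ell,\dots,k\}$. Algorithm $\mathcal A$: $s^\ell_t$ denotes the position of its $\ell$-th server after round $t$. In round $t$: set flag $:=$ false; for $\ell=k,k-1,\dots,1$: compute $Q:=Q^\ell_t(s^{\ell+1}_t,\dots,s^k_t)$; if flag is true or $\ell\le\ell_t$, set $s^\ell_t$ to a uniformly random point of $Q$ (a forced movement); else if $s^\ell_{t-1}\notin Q$, set $s^\ell_t$ to a uniformly random point of $Q$ (an unforced movement) and set flag $:=$ true; else set $s^\ell_t:=s^\ell_{t-1}$. -}

module Defs where

open import Data.Nat as ℕ using (ℕ; zero; suc; _≤_; _<_; _<ᵇ_)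
open import Data.Fin as Fin using (Fin; toℕ; fromℕ)
open import Data.Integer using (+_)
open import Data.Rational using (ℚ; _/_; 0ℚ; 1ℚ; _+_; _*_)
open import Data.List using (List; []; _∷_; length; lookup; allFin; filterᵇ; map; concatMap; foldr; take; reverse)
open import Data.Product using (_×_; _,_; proj₁; proj₂; ∃-syntax)
open import Data.Bool using (Bool; true; false; if_then_else_; _∨_; _∧_; not)
open import Relation.Nullary using (Dec; does)
open import Relation.Binary.PropositionalEquality using (_≡_)

Dist : Set → Set
Dist A = List (ℚ × A)

returnD : {A : Set} → A → Dist A
returnD a = (1ℚ , a) ∷ []

mapD : {A B : Set} → (A → B) → Dist A → Dist B
mapD f = map (λ wa → proj₁ wa , f (proj₂ wa))

bindD : {A B : Set} → Dist A → (A → Dist B) → Dist B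
bindD d f = concatMap (λ wa → map (λ wb → proj₁ wa * proj₁ wb , proj₂ wb) (f (proj₂ wa))) d

-- uniform distribution on the elements of a list; for the empty list
-- (never used on valid runs) we fall back to the given default point
uniformD : {A : Set} → List A → A → Dist A
uniformD [] a = returnD a
uniformD (x ∷ xs) _ = map (λ y → (+ 1 / suc (length xs)) , y) (x ∷ xs)

Pr : {A : Set} → Dist A → (A → Bool) → ℚ
Pr d E = foldr (λ wa acc → if E (proj₂ wa) then proj₁ wa + acc else acc) 0ℚ d

allᵇ : {A : Set} → (A → Bool) → List A → Bool
allᵇ f = foldr (λ a b → f a ∧ b) true

foldD : {S B : Set} → (S → B → Dist S) → S → List B → Dist S
foldD f s [] = returnD s
foldD f s (b ∷ bs) = bindD (f s b) (λ s' → foldD f s' bs)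

-- The model: U = Fin n, k levels.  Level index i : Fin k stands for
-- level (toℕ i + 1).

module Model (n k : ℕ) where

  U : Set
  U = Fin n

  -- an interval (a , b) stands for [a , b)
  Interval : Set
  Interval = ℕ × ℕ

  -- a hierarchical service pattern: for each level the list of its
  -- intervals, most recent (= last) interval first
  Pattern : Set
  Pattern = Fin k → List Interval

  emptyPattern : Pattern
  emptyPattern _ = []

  extendLast : ℕ → List Interval → List Interval
  extendLast t [] = []
  extendLast t ((a , b) ∷ r) = (a , suc t) ∷ r

  extend : Fin (suc k) → ℕ → Pattern → Pattern
  extend ℓ t P i = if toℕ i <ᵇ toℕ ℓ then (t , suc t) ∷ P i else extendLast t (P i)

  patternFrom : ℕ → Pattern → List (Fin (suc k)) → Pattern
  patternFrom t P [] = P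
  patternFrom t P (ℓ ∷ ℓs) = patternFrom (suc t) (extend ℓ t P) ℓs

  -- I_t built from ℓ_1,…,ℓ_t starting from the empty pattern over [1,1)
  patternOfLevels : List (Fin (suc k)) → Pattern
  patternOfLevels = patternFrom 1 emptyPattern

  Labeling : Pattern → Set
  Labeling P = (i : Fin k) → Fin (length (P i)) → U

  -- feasibility w.r.t. (σ_1,…,σ_s): request r (time toℕ r + 1) lies in an
  -- interval labeled σ_r
  Feasible : (P : Pattern) → List U → Labeling P → Set
  Feasible P σs γ = (r : Fin (length σs)) →
    ∃[ i ] ∃[ j ] (proj₁ (lookup (P i) j) ≤ suc (toℕ r)
                   × suc (toℕ r) < proj₂ (lookup (P i) j)
                   × γ i j ≡ lookup σs r)

  -- γ(L^i) = v  (the last interval is the head of the list)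
  LastIs : (P : Pattern) → Labeling P → Fin k → U → Set
  LastIs P γ i v = (j : Fin (length (P i))) → toℕ j ≡ 0 → γ i j ≡ v

  -- x ∈ Q^ℓ(p^{ℓ+1},…,p^k) for pattern P and requests σs (only the
  -- entries p i with i above ℓ are used)
  InQ : (P : Pattern) → List U → Fin k → (Fin k → U) → U → Set
  InQ P σs ℓ p x = ∃[ γ ] (Feasible P σs γ
                          × ((i : Fin k) → toℕ ℓ < toℕ i → LastIs P γ i (p i))
                          × LastIs P γ ℓ x)

  Input : Set
  Input = List (U × Fin (suc k))

  patternOf : Input → Pattern
  patternOf inp = patternOfLevels (map proj₂ inp)

  requestsOf : Input → List U
  requestsOf inp = map proj₁ inp

  Valid : Input → Set
  Valid inp = (t : ℕ) → 1 ≤ t → t ≤ length inp →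
    ∃[ γ ] Feasible (patternOf (take t inp)) (requestsOf (take t inp)) γ

  Config : Set
  Config = Fin k → U

  update : Config → Fin k → U → Config
  update c ℓ x i = if does (i Fin.≟ ℓ) then x else c i

  -- membership in Q is decidable; the algorithm is parametrised by any
  -- decision procedure (its boolean answers are uniquely determined)
  DecQ : Set
  DecQ = (P : Pattern) (σs : List U) (ℓ : Fin k) (p : Fin k → U) (x : U) → Dec (InQ P σs ℓ p x)

  module Algorithm (decQ : DecQ) where

    inQ : Pattern → List U → Fin k → Config → U → Bool
    inQ P σs ℓ c x = does (decQ P σs ℓ c x)

    members : Pattern → List U → Fin k → Config → List U
    members P σs ℓ c = filterᵇ (inQ P σs ℓ c) (allFin n)

    -- processing of level ℓ in a round; the state is (flag , servers),
    -- where servers above ℓ already hold s^i_t and servers at ℓ and below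
    -- still hold s^i_{t-1}
    levelStep : Pattern → List U → Fin (suc k) → Bool × Config → Fin k → Dist (Bool × Config)
    levelStep P σs ℓt (flag , c) ℓ =
      if flag ∨ (toℕ ℓ <ᵇ toℕ ℓt)
      then mapD (λ x → flag , update c ℓ x) (uniformD Q (c ℓ))
      else (if inQ P σs ℓ c (c ℓ)
            then returnD (flag , c)
            else mapD (λ x → true , update c ℓ x) (uniformD Q (c ℓ)))
      where
        Q : List U
        Q = members P σs ℓ c

    levelsDown : List (Fin k)
    levelsDown = reverse (allFin k)

    round : Input → Fin (suc k) → Config → Dist Config
    round hist ℓt c = mapD proj₂
      (foldD (levelStep (patternOf hist) (requestsOf hist) ℓt) (false , c) levelsDown)

    runFrom : Input → Input → Dist Config → Dist Config
    runFrom hist [] d = d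
    runFrom hist (x ∷ rest) d =
      runFrom (hist Data.List.++ (x ∷ [])) rest (bindD d (round (hist Data.List.++ (x ∷ [])) (proj₂ x)))

    run : Config → Input → Dist Config
    run c₀ inp = runFrom [] inp (returnD c₀)

    agreeAbove : Fin k → (Fin k → U) → Config → Bool
    agreeAbove ℓ p c = allᵇ (λ i → not (toℕ ℓ <ᵇ toℕ i) ∨ does (c i Fin.≟ p i)) (allFin k)

    agreeAboveAt : Fin k → (Fin k → U) → U → Config → Bool
    agreeAboveAt ℓ p x c = agreeAbove ℓ p c ∧ does (c ℓ Fin.≟ x)

{-# OPTIONS --safe #-}
-- Condition on the servers above level ℓ ending round t at p, and let Q = Q^ℓ_t(p).  Whenever
-- the server of level ℓ moves in round t it lands uniformly on Q, so P(s^ℓ_t = x) can differ from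
-- P(agree)/|Q| only through the event that it stays.  If ℓ < ℓ_t it never stays.  Otherwise no
-- level above ℓ is forced either, so staying means that no server at a level ≥ ℓ moved: the
-- configuration after round t-1 already agreed with p above ℓ, every higher server lay in its own
-- Q-set (a condition determined by p alone), and s^ℓ_{t-1} ∈ Q.  As Q^ℓ_t(p) ⊆ Q^ℓ_{t-1}(p) when
-- ℓ_t ≤ ℓ, the induction hypothesis makes every point of Q equally likely for s^ℓ_{t-1}, so staying
-- favours no point of Q either.  In the first round ℓ_1 = k forces every level.  Formally, the
-- deviation from uniformity is the expected `bias` of level ℓ's step, which vanishes in both cases.

module Submission where

open import Defs

open import Data.Bool using (Bool; true; false; if_then_else_; _∨_; _∧_; not)
open import Data.Bool.Properties using (⇔→≡; T-≡; ∧-conicalʳ; ∧-zeroʳ; ∨-zeroʳ)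
open import Data.Fin as Fin using (Fin; toℕ; fromℕ)
import Data.Fin.Properties as Fin
open import Data.Integer as ℤ using (+_)
open import Data.Integer.Tactic.RingSolver using () renaming (solve-∀ to solve-∀ℤ)
open import Data.List using (List; []; _∷_; length; lookup; allFin; filterᵇ; map; reverse; take; tabulate; _++_; _∷ʳ_)
import Data.List.Properties as LP
open import Data.List.Membership.Propositional using (_∈_)
open import Data.List.Membership.Propositional.Properties using (∈-allFin; ∈-filter⁺)
open import Data.List.Relation.Unary.All as All using (All; []; _∷_)
import Data.List.Relation.Unary.All.Properties as AP
open import Data.List.Reverse using (Reverse; reverseView; []; _∶_∶ʳ_)
open import Data.Nat as ℕ using (ℕ; zero; suc; _≤_; _<_; _<ᵇ_)
import Data.Nat.Properties as ℕ
open import Data.Product using (_×_; _,_; proj₁; proj₂; ∃-syntax; Σ-syntax)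
open import Data.Rational using (ℚ; 0ℚ; 1ℚ; _+_; _*_; _-_; _/_; toℚᵘ)
open import Data.Rational.Properties
  using ( toℚᵘ-injective; toℚᵘ-fromℚᵘ; toℚᵘ-homo-+; toℚᵘ-homo-*; +-*-commutativeRing; _≟_
        ; *-identityˡ; *-identityʳ; *-zeroˡ; *-zeroʳ; +-identityˡ; +-identityʳ; *-comm; *-assoc; +-assoc; +-inverseʳ)
import Data.Rational.Unnormalised as ℚᵘ
import Data.Rational.Unnormalised.Properties as ℚᵘ
open import Data.Sum using (_⊎_; inj₁; inj₂)
open import Data.Unit using (⊤; tt)
open import Function.Base using (_∘_; case_of_)
open import Function.Bundles using (_⇔_; mk⇔; Equivalence)
open import Level using (0ℓ)
open import Relation.Binary.PropositionalEquality
open import Relation.Nullary using (Dec; does; yes; no; ¬_; contradiction)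
open import Relation.Nullary.Decidable using (dec⇒maybe; does-⇔; dec-true; dec-false; T?)
open import Relation.Nullary.Reflects using (ofʸ; ofⁿ)
open import Tactic.RingSolver using (solve-∀)
open import Tactic.RingSolver.Core.AlmostCommutativeRing using (AlmostCommutativeRing; fromCommutativeRing)

ℚ-ring : AlmostCommutativeRing 0ℓ 0ℓ
ℚ-ring = fromCommutativeRing +-*-commutativeRing (λ x → dec⇒maybe (0ℚ ≟ x))

ℕ→ℚ : ℕ → ℚ
ℕ→ℚ a = + a / 1

ℕ→ℚ-suc : ∀ a → ℕ→ℚ (suc a) ≡ 1ℚ + ℕ→ℚ a
ℕ→ℚ-suc a = toℚᵘ-injective (begin
  toℚᵘ (ℕ→ℚ (suc a))             ≈⟨ toℚᵘ-fromℚᵘ (ℚᵘ.mkℚᵘ (+ suc a) 0) ⟩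
  ℚᵘ.mkℚᵘ (+ suc a) 0            ≈⟨ ℚᵘ.*≡* (cross-multiplied (+ a)) ⟩
  ℚᵘ.1ℚᵘ ℚᵘ.+ ℚᵘ.mkℚᵘ (+ a) 0    ≈⟨ ℚᵘ.+-congʳ ℚᵘ.1ℚᵘ (toℚᵘ-fromℚᵘ (ℚᵘ.mkℚᵘ (+ a) 0)) ⟨
  toℚᵘ 1ℚ ℚᵘ.+ toℚᵘ (ℕ→ℚ a)      ≈⟨ toℚᵘ-homo-+ 1ℚ (ℕ→ℚ a) ⟨
  toℚᵘ (1ℚ + ℕ→ℚ a)              ∎)
  where
  open ℚᵘ.≃-Reasoning
  cross-multiplied : ∀ (z : ℤ.ℤ) → (+ 1 ℤ.+ z) ℤ.* + 1 ≡ (+ 1 ℤ.* + 1 ℤ.+ z ℤ.* + 1) ℤ.* + 1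
  cross-multiplied = solve-∀ℤ

1/suc*suc≡1 : ∀ a → (+ 1 / suc a) * ℕ→ℚ (suc a) ≡ 1ℚ
1/suc*suc≡1 a = toℚᵘ-injective (begin
  toℚᵘ ((+ 1 / suc a) * ℕ→ℚ (suc a))               ≈⟨ toℚᵘ-homo-* (+ 1 / suc a) (ℕ→ℚ (suc a)) ⟩
  toℚᵘ (+ 1 / suc a) ℚᵘ.* toℚᵘ (ℕ→ℚ (suc a))
    ≈⟨ ℚᵘ.*-cong (toℚᵘ-fromℚᵘ (ℚᵘ.mkℚᵘ (+ 1) a)) (toℚᵘ-fromℚᵘ (ℚᵘ.mkℚᵘ (+ suc a) 0)) ⟩
  ℚᵘ.mkℚᵘ (+ 1) a ℚᵘ.* ℚᵘ.mkℚᵘ (+ suc a) 0        ≈⟨ ℚᵘ.*-inverseˡ (ℚᵘ.mkℚᵘ (+ suc a) 0) ⟩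
  ℚᵘ.1ℚᵘ                                           ∎)
  where open ℚᵘ.≃-Reasoning

1/suc-cancel : ∀ a x → (+ 1 / suc a) * (x * ℕ→ℚ (suc a)) ≡ x
1/suc-cancel a x = begin
  (+ 1 / suc a) * (x * ℕ→ℚ (suc a)) ≡⟨ swap (+ 1 / suc a) x (ℕ→ℚ (suc a)) ⟩
  x * ((+ 1 / suc a) * ℕ→ℚ (suc a)) ≡⟨ cong (x *_) (1/suc*suc≡1 a) ⟩
  x * 1ℚ                            ≡⟨ *-identityʳ x ⟩
  x                                 ∎
  where
  open ≡-Reasoning
  swap : ∀ (w x m : ℚ) → w * (x * m) ≡ x * (w * m)
  swap = solve-∀ ℚ-ring

*-cancelʳ-suc : ∀ a {u v : ℚ} → u * ℕ→ℚ (suc a) ≡ v * ℕ→ℚ (suc a) → u ≡ v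
*-cancelʳ-suc a {u} {v} eq = begin
  u                                 ≡⟨ 1/suc-cancel a u ⟨
  (+ 1 / suc a) * (u * ℕ→ℚ (suc a)) ≡⟨ cong ((+ 1 / suc a) *_) eq ⟩
  (+ 1 / suc a) * (v * ℕ→ℚ (suc a)) ≡⟨ 1/suc-cancel a v ⟩
  v                                 ∎
  where open ≡-Reasoning

𝟙 : Bool → ℚ
𝟙 true  = 1ℚ
𝟙 false = 0ℚ

𝟙-⇒-*-distrib : ∀ (w : ℚ) q e → (e ≡ true → q ≡ true) → 𝟙 q * (𝟙 e - w) ≡ 𝟙 e - w * 𝟙 q
𝟙-⇒-*-distrib w true  e     _   = one w (𝟙 e)
  where
  one : ∀ (w h : ℚ) → 1ℚ * (h - w) ≡ h - w * 1ℚ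
  one = solve-∀ ℚ-ring
𝟙-⇒-*-distrib w false false _   = nothing w
  where
  nothing : ∀ (w : ℚ) → 0ℚ * (0ℚ - w) ≡ 0ℚ - w * 0ℚ
  nothing = solve-∀ ℚ-ring
𝟙-⇒-*-distrib w false true  e⇒q = case e⇒q refl of λ ()

-- Expectations

module _ {A : Set} where

  𝔼 : Dist A → (A → ℚ) → ℚ
  𝔼 []            g = 0ℚ
  𝔼 ((w , a) ∷ d) g = w * g a + 𝔼 d g

  -- Sums are expectations against the counting measure, so the 𝔼 lemmas apply to them.
  ∑ : List A → (A → ℚ) → ℚ
  ∑ l = 𝔼 (map (1ℚ ,_) l)

  Pr≡𝔼 : (d : Dist A) (E : A → Bool) → Pr d E ≡ 𝔼 d (λ a → 𝟙 (E a))
  Pr≡𝔼 []            E = refl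
  Pr≡𝔼 ((w , a) ∷ d) E with E a
  ... | true  = cong₂ _+_ (sym (*-identityʳ w)) (Pr≡𝔼 d E)
  ... | false = trans (Pr≡𝔼 d E) (sym (trans (cong (_+ _) (*-zeroʳ w)) (+-identityˡ _)))

  𝔼-cong : (d : Dist A) {g h : A → ℚ} → (∀ a → g a ≡ h a) → 𝔼 d g ≡ 𝔼 d h
  𝔼-cong []            eq = refl
  𝔼-cong ((w , a) ∷ d) eq = cong₂ (λ u v → w * u + v) (eq a) (𝔼-cong d eq)

  𝔼-+ : (d : Dist A) (g h : A → ℚ) → 𝔼 d (λ a → g a + h a) ≡ 𝔼 d g + 𝔼 d h
  𝔼-+ []            g h = sym (+-identityˡ 0ℚ)
  𝔼-+ ((w , a) ∷ d) g h = trans (cong (_+_ (w * (g a + h a))) (𝔼-+ d g h)) (shuffle w (g a) (h a) (𝔼 d g) (𝔼 d h))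
    where
    shuffle : ∀ (w x y u v : ℚ) → w * (x + y) + (u + v) ≡ (w * x + u) + (w * y + v)
    shuffle = solve-∀ ℚ-ring

  𝔼-*ˡ : (d : Dist A) (c : ℚ) (g : A → ℚ) → 𝔼 d (λ a → c * g a) ≡ c * 𝔼 d g
  𝔼-*ˡ []            c g = sym (*-zeroʳ c)
  𝔼-*ˡ ((w , a) ∷ d) c g = trans (cong (_+_ (w * (c * g a))) (𝔼-*ˡ d c g)) (pull w c (g a) (𝔼 d g))
    where
    pull : ∀ (w c x u : ℚ) → w * (c * x) + c * u ≡ c * (w * x + u)
    pull = solve-∀ ℚ-ring

  𝔼-- : (d : Dist A) (g h : A → ℚ) → 𝔼 d (λ a → g a - h a) ≡ 𝔼 d g - 𝔼 d h
  𝔼-- []            g h = sym (+-inverseʳ 0ℚ)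
  𝔼-- ((w , a) ∷ d) g h = trans (cong (_+_ (w * (g a - h a))) (𝔼-- d g h)) (shuffle w (g a) (h a) (𝔼 d g) (𝔼 d h))
    where
    shuffle : ∀ (w x y u v : ℚ) → w * (x - y) + (u - v) ≡ (w * x + u) - (w * y + v)
    shuffle = solve-∀ ℚ-ring

  𝔼-zero : (d : Dist A) → 𝔼 d (λ _ → 0ℚ) ≡ 0ℚ
  𝔼-zero d = trans (𝔼-cong d (λ _ → sym (*-zeroˡ 0ℚ))) (trans (𝔼-*ˡ d 0ℚ (λ _ → 0ℚ)) (*-zeroˡ (𝔼 d (λ _ → 0ℚ))))

  𝔼-++ : (d e : Dist A) (g : A → ℚ) → 𝔼 (d ++ e) g ≡ 𝔼 d g + 𝔼 e g
  𝔼-++ []            e g = sym (+-identityˡ (𝔼 e g))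
  𝔼-++ ((w , a) ∷ d) e g = trans (cong (_+_ (w * g a)) (𝔼-++ d e g)) (sym (+-assoc (w * g a) (𝔼 d g) (𝔼 e g)))

  𝔼-return : (a : A) (g : A → ℚ) → 𝔼 (returnD a) g ≡ g a
  𝔼-return a g = trans (+-identityʳ (1ℚ * g a)) (*-identityˡ (g a))

  𝔼-rescale : (w : ℚ) (d : Dist A) (g : A → ℚ) → 𝔼 (map (λ va → w * proj₁ va , proj₂ va) d) g ≡ w * 𝔼 d g
  𝔼-rescale w []            g = sym (*-zeroʳ w)
  𝔼-rescale w ((v , a) ∷ d) g = trans (cong (_+_ (w * v * g a)) (𝔼-rescale w d g)) (pull w v (g a) (𝔼 d g))
    where
    pull : ∀ (w v x u : ℚ) → w * v * x + w * u ≡ w * (v * x + u)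
    pull = solve-∀ ℚ-ring

  𝔼-weighted : (w : ℚ) (l : List A) (g : A → ℚ) → 𝔼 (map (w ,_) l) g ≡ w * ∑ l g
  𝔼-weighted w []      g = sym (*-zeroʳ w)
  𝔼-weighted w (a ∷ l) g = trans (cong (_+_ (w * g a)) (𝔼-weighted w l g)) (pull w (g a) (∑ l g))
    where
    pull : ∀ (w x u : ℚ) → w * x + w * u ≡ w * (1ℚ * x + u)
    pull = solve-∀ ℚ-ring

  ∑-const : (l : List A) (r : ℚ) → ∑ l (λ _ → r) ≡ r * ℕ→ℚ (length l)
  ∑-const []      r = sym (*-zeroʳ r)
  ∑-const (a ∷ l) r = begin
    1ℚ * r + ∑ l (λ _ → r)       ≡⟨ cong (_+_ (1ℚ * r)) (∑-const l r) ⟩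
    1ℚ * r + r * ℕ→ℚ (length l)  ≡⟨ distrib r (ℕ→ℚ (length l)) ⟩
    r * (1ℚ + ℕ→ℚ (length l))    ≡⟨ cong (r *_) (ℕ→ℚ-suc (length l)) ⟨
    r * ℕ→ℚ (suc (length l))     ∎
    where
    open ≡-Reasoning
    distrib : ∀ (r m : ℚ) → 1ℚ * r + r * m ≡ r * (1ℚ + m)
    distrib = solve-∀ ℚ-ring

  ∑-filterᵇ : (q : A → Bool) (l : List A) (g : A → ℚ) →
    ∑ (filterᵇ q l) g ≡ ∑ l (λ a → if q a then g a else 0ℚ)
  ∑-filterᵇ q []      g = refl
  ∑-filterᵇ q (a ∷ l) g with q a
  ... | true  = cong (_+_ (1ℚ * g a)) (∑-filterᵇ q l g)
  ... | false = trans (∑-filterᵇ q l g) (sym (trans (cong (_+ rest) (*-zeroʳ 1ℚ)) (+-identityˡ rest)))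
    where
    rest : ℚ
    rest = ∑ l (λ a → if q a then g a else 0ℚ)

  ∑-filterᵇ-cong : (q : A → Bool) (l : List A) {g h : A → ℚ} →
    (∀ a → q a ≡ true → g a ≡ h a) → ∑ (filterᵇ q l) g ≡ ∑ (filterᵇ q l) h
  ∑-filterᵇ-cong q []      eq = refl
  ∑-filterᵇ-cong q (a ∷ l) eq with q a in qa
  ... | true  = cong₂ (λ u v → 1ℚ * u + v) (eq a qa) (∑-filterᵇ-cong q l eq)
  ... | false = ∑-filterᵇ-cong q l eq

module _ {A B : Set} where

  𝔼-mapD : (f : A → B) (d : Dist A) (g : B → ℚ) → 𝔼 (mapD f d) g ≡ 𝔼 d (λ a → g (f a))
  𝔼-mapD f []            g = refl
  𝔼-mapD f ((w , a) ∷ d) g = cong (_+_ (w * g (f a))) (𝔼-mapD f d g)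

  𝔼-bindD : (d : Dist A) (f : A → Dist B) (g : B → ℚ) → 𝔼 (bindD d f) g ≡ 𝔼 d (λ a → 𝔼 (f a) g)
  𝔼-bindD []            f g = refl
  𝔼-bindD ((w , a) ∷ d) f g = begin
    𝔼 (map (λ vb → w * proj₁ vb , proj₂ vb) (f a) ++ bindD d f) g
      ≡⟨ 𝔼-++ (map (λ vb → w * proj₁ vb , proj₂ vb) (f a)) (bindD d f) g ⟩
    𝔼 (map (λ vb → w * proj₁ vb , proj₂ vb) (f a)) g + 𝔼 (bindD d f) g
      ≡⟨ cong₂ _+_ (𝔼-rescale w (f a) g) (𝔼-bindD d f g) ⟩
    w * 𝔼 (f a) g + 𝔼 d (λ a → 𝔼 (f a) g) ∎
    where open ≡-Reasoning

  𝔼-comm : (d : Dist A) (e : Dist B) (f : A → B → ℚ) →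
    𝔼 d (λ a → 𝔼 e (f a)) ≡ 𝔼 e (λ b → 𝔼 d (λ a → f a b))
  𝔼-comm []            e f = sym (𝔼-zero e)
  𝔼-comm ((w , a) ∷ d) e f = begin
    w * 𝔼 e (f a) + 𝔼 d (λ a → 𝔼 e (f a))
      ≡⟨ cong₂ _+_ (𝔼-*ˡ e w (f a)) (sym (𝔼-comm d e f)) ⟨
    𝔼 e (λ b → w * f a b) + 𝔼 e (λ b → 𝔼 d (λ a → f a b))
      ≡⟨ 𝔼-+ e (λ b → w * f a b) (λ b → 𝔼 d (λ a → f a b)) ⟨
    𝔼 e (λ b → w * f a b + 𝔼 d (λ a → f a b)) ∎
    where open ≡-Reasoning

module _ {S B : Set} (f : S → B → Dist S) where

  𝔼-foldD-∷ : (s : S) (b : B) (bs : List B) (g : S → ℚ) →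
    𝔼 (foldD f s (b ∷ bs)) g ≡ 𝔼 (f s b) (λ s′ → 𝔼 (foldD f s′ bs) g)
  𝔼-foldD-∷ s b bs = 𝔼-bindD (f s b) (λ s′ → foldD f s′ bs)

  𝔼-foldD-++ : (s : S) (bs cs : List B) (g : S → ℚ) →
    𝔼 (foldD f s (bs ++ cs)) g ≡ 𝔼 (foldD f s bs) (λ s′ → 𝔼 (foldD f s′ cs) g)
  𝔼-foldD-++ s []       cs g = sym (𝔼-return s (λ s′ → 𝔼 (foldD f s′ cs) g))
  𝔼-foldD-++ s (b ∷ bs) cs g = begin
    𝔼 (foldD f s (b ∷ bs ++ cs)) g
      ≡⟨ 𝔼-foldD-∷ s b (bs ++ cs) g ⟩
    𝔼 (f s b) (λ s′ → 𝔼 (foldD f s′ (bs ++ cs)) g)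
      ≡⟨ 𝔼-cong (f s b) (λ s′ → 𝔼-foldD-++ s′ bs cs g) ⟩
    𝔼 (f s b) (λ s′ → 𝔼 (foldD f s′ bs) (λ s″ → 𝔼 (foldD f s″ cs) g))
      ≡⟨ 𝔼-foldD-∷ s b bs _ ⟨
    𝔼 (foldD f s (b ∷ bs)) (λ s″ → 𝔼 (foldD f s″ cs) g) ∎
    where open ≡-Reasoning

module _ {A : Set} where

  𝔼-uniformD : (y : A) (ys : List A) (z : A) (g : A → ℚ) →
    𝔼 (uniformD (y ∷ ys) z) g ≡ (+ 1 / suc (length ys)) * ∑ (y ∷ ys) g
  𝔼-uniformD y ys z = 𝔼-weighted (+ 1 / suc (length ys)) (y ∷ ys)

  𝔼-uniformD-const : (l : List A) (z : A) (g : A → ℚ) (r : ℚ) → (∀ a → g a ≡ r) → 𝔼 (uniformD l z) g ≡ r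
  𝔼-uniformD-const []       z g r eq = trans (𝔼-return z g) (eq z)
  𝔼-uniformD-const (y ∷ ys) z g r eq = begin
    𝔼 (uniformD (y ∷ ys) z) g    ≡⟨ 𝔼-uniformD y ys z g ⟩
    w * ∑ (y ∷ ys) g             ≡⟨ cong (w *_) (𝔼-cong (map (1ℚ ,_) (y ∷ ys)) eq) ⟩
    w * ∑ (y ∷ ys) (λ _ → r)     ≡⟨ cong (w *_) (∑-const (y ∷ ys) r) ⟩
    w * (r * m)                  ≡⟨ 1/suc-cancel (length ys) r ⟩
    r                            ∎
    where
    open ≡-Reasoning
    w m : ℚ
    w = + 1 / suc (length ys)
    m = ℕ→ℚ (suc (length ys))

∑-tabulate : ∀ {A : Set} {m} (f : Fin m → A) (g : A → ℚ) → ∑ (tabulate f) g ≡ ∑ (allFin m) (λ i → g (f i))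
∑-tabulate {m = zero}  f g = refl
∑-tabulate {m = suc m} f g =
  cong (_+_ (1ℚ * g (f Fin.zero)))
    (trans (∑-tabulate (λ i → f (Fin.suc i)) g) (sym (∑-tabulate Fin.suc (λ i → g (f i)))))

∑-allFin-δ : ∀ {m} (z : Fin m) (h : Fin m → ℚ) → ∑ (allFin m) (λ y → if does (z Fin.≟ y) then h y else 0ℚ) ≡ h z
∑-allFin-δ {suc m} Fin.zero h = begin
  1ℚ * h Fin.zero + ∑ (tabulate Fin.suc) δ
    ≡⟨ cong (_+_ (1ℚ * h Fin.zero)) (trans (∑-tabulate Fin.suc δ) (𝔼-zero (map (1ℚ ,_) (allFin m)))) ⟩
  1ℚ * h Fin.zero + 0ℚ
    ≡⟨ 𝔼-return Fin.zero h ⟩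
  h Fin.zero ∎
  where
  open ≡-Reasoning
  δ : Fin (suc m) → ℚ
  δ y = if does (Fin.zero Fin.≟ y) then h y else 0ℚ
∑-allFin-δ {suc m} (Fin.suc z) h = begin
  1ℚ * 0ℚ + ∑ (tabulate Fin.suc) δ    ≡⟨ cong₂ _+_ (*-zeroʳ 1ℚ) (∑-tabulate Fin.suc δ) ⟩
  0ℚ + ∑ (allFin m) (λ i → δ (Fin.suc i)) ≡⟨ +-identityˡ _ ⟩
  ∑ (allFin m) (λ i → δ (Fin.suc i))  ≡⟨ ∑-allFin-δ z (λ i → h (Fin.suc i)) ⟩
  h (Fin.suc z)                       ∎
  where
  open ≡-Reasoning
  δ : Fin (suc m) → ℚ
  δ y = if does (Fin.suc z Fin.≟ y) then h y else 0ℚ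

∑-members-δ : ∀ {m} (q : Fin m → Bool) (z : Fin m) → ∑ (filterᵇ q (allFin m)) (λ y → 𝟙 (does (z Fin.≟ y))) ≡ 𝟙 (q z)
∑-members-δ {m} q z = begin
  ∑ (filterᵇ q (allFin m)) (λ y → 𝟙 (does (z Fin.≟ y)))
    ≡⟨ ∑-filterᵇ q (allFin m) (λ y → 𝟙 (does (z Fin.≟ y))) ⟩
  ∑ (allFin m) (λ y → if q y then 𝟙 (does (z Fin.≟ y)) else 0ℚ)
    ≡⟨ 𝔼-cong (map (1ℚ ,_) (allFin m)) swap ⟩
  ∑ (allFin m) (λ y → if does (z Fin.≟ y) then 𝟙 (q y) else 0ℚ)
    ≡⟨ ∑-allFin-δ z (λ y → 𝟙 (q y)) ⟩
  𝟙 (q z) ∎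
  where
  open ≡-Reasoning
  swap : ∀ y → (if q y then 𝟙 (does (z Fin.≟ y)) else 0ℚ) ≡ (if does (z Fin.≟ y) then 𝟙 (q y) else 0ℚ)
  swap y with q y | does (z Fin.≟ y)
  ... | true  | true  = refl
  ... | true  | false = refl
  ... | false | true  = refl
  ... | false | false = refl

does⇒ : {A : Set} (a? : Dec A) → does a? ≡ true → A
does⇒ (yes a) _  = a
does⇒ (no _)  ()

<ᵇ≡false : ∀ {m n} → n ≤ m → (m <ᵇ n) ≡ false
<ᵇ≡false {m} {n} n≤m with m <ᵇ n | ℕ.<ᵇ-reflects-< m n
... | false | _       = refl
... | true  | ofʸ m<n = contradiction n≤m (ℕ.<⇒≱ m<n)

<ᵇ≡true : ∀ {m n} → m < n → (m <ᵇ n) ≡ true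
<ᵇ≡true m<n = Equivalence.to T-≡ (ℕ.<⇒<ᵇ m<n)

allᵇ≡true⇔All : {A : Set} (f : A → Bool) (xs : List A) → allᵇ f xs ≡ true ⇔ All (λ a → f a ≡ true) xs
allᵇ≡true⇔All f []       = mk⇔ (λ _ → []) (λ _ → refl)
allᵇ≡true⇔All f (x ∷ xs) with f x in fx
... | true  = mk⇔ (λ e → fx ∷ Equivalence.to (allᵇ≡true⇔All f xs) e)
                  (λ where (_ ∷ es) → Equivalence.from (allᵇ≡true⇔All f xs) es)
... | false = mk⇔ (λ ()) (λ where (e ∷ _) → contradiction (trans (sym fx) e) λ ())

allᵇ-cong : {A : Set} {f g : A → Bool} {xs : List A} → All (λ a → f a ≡ g a) xs → allᵇ f xs ≡ allᵇ g xs
allᵇ-cong []         = refl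
allᵇ-cong (e ∷ es) = cong₂ _∧_ e (allᵇ-cong es)

filterᵇ-cong : {A : Set} {f g : A → Bool} (xs : List A) → (∀ a → f a ≡ g a) → filterᵇ f xs ≡ filterᵇ g xs
filterᵇ-cong {f = f} {g} []       eq = refl
filterᵇ-cong {f = f} {g} (x ∷ xs) eq with f x | g x | eq x
... | true  | true  | refl = cong (x ∷_) (filterᵇ-cong xs eq)
... | false | false | refl = filterᵇ-cong xs eq

∈⇒nonempty : {A : Set} {x : A} (xs : List A) → x ∈ xs → Σ[ y ∈ A ] Σ[ ys ∈ List A ] xs ≡ y ∷ ys
∈⇒nonempty (y ∷ ys) _ = y , ys , refl

allFin-split : ∀ {m} (ℓ : Fin m) → Σ[ below ∈ List (Fin m) ] Σ[ above ∈ List (Fin m) ]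
  (allFin m ≡ below ++ ℓ ∷ above) × All (λ i → toℕ i < toℕ ℓ) below × All (λ i → toℕ ℓ < toℕ i) above
allFin-split {suc m} Fin.zero = [] , tabulate Fin.suc , refl , [] , AP.tabulate⁺ (λ _ → ℕ.z<s)
allFin-split {suc m} (Fin.suc ℓ) with allFin-split ℓ
... | below , above , allFin≡ , below< , above> =
  Fin.zero ∷ map Fin.suc below , map Fin.suc above ,
  cong (Fin.zero ∷_) (begin
    tabulate Fin.suc                        ≡⟨ LP.map-tabulate (λ i → i) Fin.suc ⟨
    map Fin.suc (allFin m)                  ≡⟨ cong (map Fin.suc) allFin≡ ⟩
    map Fin.suc (below ++ ℓ ∷ above)        ≡⟨ LP.map-++ Fin.suc below (ℓ ∷ above) ⟩
    map Fin.suc below ++ map Fin.suc (ℓ ∷ above) ∎) ,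
  ℕ.z<s ∷ AP.map⁺ (All.map ℕ.s<s below<) , AP.map⁺ (All.map ℕ.s<s above>)
  where open ≡-Reasoning

All-reverse : {A : Set} {R : A → Set} {xs : List A} → All R xs → All R (reverse xs)
All-reverse {xs = []}     []         = []
All-reverse {xs = x ∷ xs} (rx ∷ rxs) = subst (All _) (sym (LP.unfold-reverse x xs)) (AP.∷ʳ⁺ (All-reverse rxs) rx)

lookup-++ˡ : {A : Set} (xs ys : List A) (r : Fin (length xs)) →
  ∃[ r′ ] (toℕ r′ ≡ toℕ r × lookup (xs ++ ys) r′ ≡ lookup xs r)
lookup-++ˡ (x ∷ xs) ys Fin.zero    = Fin.zero , refl , refl
lookup-++ˡ (x ∷ xs) ys (Fin.suc r) with lookup-++ˡ xs ys r
... | r′ , r′≡r , lookup≡ = Fin.suc r′ , cong suc r′≡r , lookup≡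

length-∷ʳ : {A : Set} (xs : List A) (x : A) → length (xs ∷ʳ x) ≡ suc (length xs)
length-∷ʳ xs x = trans (LP.length-++ xs) (ℕ.+-comm (length xs) 1)


-- Service patterns

module _ {n k : ℕ} where
  open Model n k

  SameAbove : Fin k → Config → Config → Set
  SameAbove ℓ c c′ = ∀ i → toℕ ℓ < toℕ i → c i ≡ c′ i

  update-self : (c : Config) (ℓ : Fin k) (y : U) → update c ℓ y ℓ ≡ y
  update-self c ℓ y with ℓ Fin.≟ ℓ
  ... | yes _  = refl
  ... | no ℓ≢ℓ = contradiction refl ℓ≢ℓ

  update-other : (c : Config) (ℓ : Fin k) (y : U) {i : Fin k} → i ≢ ℓ → update c ℓ y i ≡ c i
  update-other c ℓ y {i} i≢ℓ with i Fin.≟ ℓ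
  ... | yes i≡ℓ = contradiction i≡ℓ i≢ℓ
  ... | no _    = refl

  update-SameAbove : (c : Config) {i ℓ : Fin k} (y : U) → toℕ i ≤ toℕ ℓ → SameAbove ℓ (update c i y) c
  update-SameAbove c y i≤ℓ j ℓ<j = update-other c _ y (λ j≡i → ℕ.<⇒≱ ℓ<j (subst (λ j → toℕ j ≤ _) (sym j≡i) i≤ℓ))

  InQ-SameAbove : ∀ {P σs ℓ p p′ y} → SameAbove ℓ p p′ → InQ P σs ℓ p y → InQ P σs ℓ p′ y
  InQ-SameAbove {P} p≈p′ (γ , feasible , lastAbove , lastℓ) =
    γ , feasible , (λ i ℓ<i → subst (LastIs P γ i) (p≈p′ i ℓ<i) (lastAbove i ℓ<i)) , lastℓ

  _∈ᴵ_ : ℕ → Interval → Set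
  u ∈ᴵ I = proj₁ I ≤ u × u < proj₂ I

  LastEndsAt : List Interval → ℕ → Set
  LastEndsAt []            t = ⊤
  LastEndsAt ((_ , b) ∷ _) t = b ≡ t

  record Restriction (t : ℕ) (L L′ : List Interval) : Set where
    field
      embed : Fin (length L) → Fin (length L′)
      reflect : ∀ {u} j′ → u < t → u ∈ᴵ lookup L′ j′ → ∃[ j ] (embed j ≡ j′ × u ∈ᴵ lookup L j)

  extendLevel : Bool → ℕ → List Interval → List Interval
  extendLevel new t L = if new then (t , suc t) ∷ L else extendLast t L

  restriction : ∀ new t L → LastEndsAt L t → Restriction t L (extendLevel new t L)
  restriction true t L _ = record { embed = Fin.suc ; reflect = reflect }
    where
    reflect : ∀ {u} j′ → u < t → u ∈ᴵ lookup ((t , suc t) ∷ L) j′ → ∃[ j ] (Fin.suc j ≡ j′ × u ∈ᴵ lookup L j)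
    reflect Fin.zero    u<t (t≤u , _) = contradiction u<t (ℕ.≤⇒≯ t≤u)
    reflect (Fin.suc j) _   u∈I       = j , refl , u∈I
  restriction false t []            _ = record { embed = λ () ; reflect = λ () }
  restriction false t ((a , b) ∷ L) b≡t = record { embed = λ j → j ; reflect = reflect }
    where
    reflect : ∀ {u} j′ → u < t → u ∈ᴵ lookup ((a , suc t) ∷ L) j′ → ∃[ j ] (j ≡ j′ × u ∈ᴵ lookup ((a , b) ∷ L) j)
    reflect Fin.zero    u<t (a≤u , _) = Fin.zero , refl , a≤u , subst (_ <_) (sym b≡t) u<t
    reflect (Fin.suc j) _   u∈I       = Fin.suc j , refl , u∈I

  restriction-keeps-last : ∀ {new} t L (b≡t : LastEndsAt L t) → new ≡ false →
    ∀ j → toℕ j ≡ 0 → toℕ (Restriction.embed (restriction new t L b≡t) j) ≡ 0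
  restriction-keeps-last t ((a , b) ∷ L) _ refl j j≡0 = j≡0

  InQ-extend⁻ : ∀ {P σs σ ℓt t ℓ p x} → (∀ i → LastEndsAt (P i) t) → length σs < t → toℕ ℓt ≤ toℕ ℓ →
    InQ (extend ℓt t P) (σs ∷ʳ σ) ℓ p x → InQ P σs ℓ p x
  InQ-extend⁻ {P} {σs} {σ} {ℓt} {t} {ℓ} {p} {x} lastEnds |σs|<t ℓt≤ℓ (γ , feasible , lastAbove , lastℓ) =
    γ′ , feasible′ , (λ i ℓ<i j j≡0 → lastAbove i ℓ<i (embed i j) (keeps-last i (ℕ.<⇒≤ ℓ<i) j j≡0)) ,
    (λ j j≡0 → lastℓ (embed ℓ j) (keeps-last ℓ ℕ.≤-refl j j≡0))
    where
    R : ∀ i → Restriction t (P i) (extend ℓt t P i)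
    R i = restriction (toℕ i <ᵇ toℕ ℓt) t (P i) (lastEnds i)
    embed : ∀ i → Fin (length (P i)) → Fin (length (extend ℓt t P i))
    embed i = Restriction.embed (R i)
    γ′ : Labeling P
    γ′ i j = γ i (embed i j)
    keeps-last : ∀ i → toℕ ℓ ≤ toℕ i → ∀ j → toℕ j ≡ 0 → toℕ (embed i j) ≡ 0
    keeps-last i ℓ≤i = restriction-keeps-last t (P i) (lastEnds i) (<ᵇ≡false (ℕ.≤-trans ℓt≤ℓ ℓ≤i))
    feasible′ : Feasible P σs γ′
    feasible′ r with lookup-++ˡ σs (σ ∷ []) r
    ... | r′ , r′≡r , lookup≡ with feasible r′
    ...   | i , j′ , start≤u , u<end , label
            with Restriction.reflect (R i) j′ (subst (_< t) (cong suc (sym r′≡r)) (ℕ.≤-<-trans (Fin.toℕ<n r) |σs|<t))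
                                              (start≤u , u<end)
    ...     | j , refl , u∈I = let start≤u′ , u<end′ = subst (λ u → u ∈ᴵ lookup (P i) j) (cong suc r′≡r) u∈I
                               in i , j , start≤u′ , u<end′ , trans label lookup≡

  patternFrom-snoc : ∀ t P ℓs ℓ → patternFrom t P (ℓs ∷ʳ ℓ) ≡ extend ℓ (t ℕ.+ length ℓs) (patternFrom t P ℓs)
  patternFrom-snoc t P []        ℓ = cong (λ u → extend ℓ u P) (sym (ℕ.+-identityʳ t))
  patternFrom-snoc t P (ℓ′ ∷ ℓs) ℓ = trans (patternFrom-snoc (suc t) (extend ℓ′ t P) ℓs ℓ)
    (cong (λ u → extend ℓ u (patternFrom (suc t) (extend ℓ′ t P) ℓs)) (sym (ℕ.+-suc t (length ℓs))))

  patternOf-snoc : ∀ h y → patternOf (h ∷ʳ y) ≡ extend (proj₂ y) (suc (length h)) (patternOf h)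
  patternOf-snoc h y = begin
    patternFrom 1 emptyPattern (map proj₂ (h ∷ʳ y))
      ≡⟨ cong (patternFrom 1 emptyPattern) (LP.map-++ proj₂ h (y ∷ [])) ⟩
    patternFrom 1 emptyPattern (map proj₂ h ∷ʳ proj₂ y)
      ≡⟨ patternFrom-snoc 1 emptyPattern (map proj₂ h) (proj₂ y) ⟩
    extend (proj₂ y) (suc (length (map proj₂ h))) (patternOf h)
      ≡⟨ cong (λ u → extend (proj₂ y) (suc u) (patternOf h)) (LP.length-map proj₂ h) ⟩
    extend (proj₂ y) (suc (length h)) (patternOf h) ∎
    where open ≡-Reasoning

  requestsOf-snoc : ∀ h y → requestsOf (h ∷ʳ y) ≡ requestsOf h ∷ʳ proj₁ y
  requestsOf-snoc h y = LP.map-++ proj₁ h (y ∷ [])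

  lastEnds : ∀ h i → LastEndsAt (patternOf h i) (suc (length h))
  lastEnds h i with reverseView h
  ... | []           = tt
  ... | h′ ∶ _ ∶ʳ y  =
    subst₂ (λ P t → LastEndsAt (P i) t) (sym (patternOf-snoc h′ y)) (cong suc (sym (length-∷ʳ h′ y)))
      (extendLevel-endsAt (toℕ i <ᵇ toℕ (proj₂ y)) (patternOf h′ i))
    where
    extendLevel-endsAt : ∀ new L → LastEndsAt (extendLevel new (suc (length h′)) L) (suc (suc (length h′)))
    extendLevel-endsAt true  L            = refl
    extendLevel-endsAt false []           = tt
    extendLevel-endsAt false (_ ∷ _)      = refl

  InQ-snoc⁻ : ∀ h y {ℓ p x} → toℕ (proj₂ y) ≤ toℕ ℓ →
    InQ (patternOf (h ∷ʳ y)) (requestsOf (h ∷ʳ y)) ℓ p x → InQ (patternOf h) (requestsOf h) ℓ p x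
  InQ-snoc⁻ h y {ℓ} {p} {x} ℓt≤ℓ q =
    InQ-extend⁻ {P = patternOf h} {σs = requestsOf h} (lastEnds h) (ℕ.≤-reflexive (cong suc (LP.length-map proj₁ h))) ℓt≤ℓ
      (subst₂ (λ P σs → InQ P σs ℓ p x) (patternOf-snoc h y) (requestsOf-snoc h y) q)

-- One round of the algorithm

module _ {n k : ℕ} (decQ : Model.DecQ n k) where
  open Model n k
  open Algorithm decQ

  inQ-SameAbove : ∀ {P σs ℓ p p′} y → SameAbove ℓ p p′ → inQ P σs ℓ p y ≡ inQ P σs ℓ p′ y
  inQ-SameAbove {P} {σs} {ℓ} {p} {p′} y p≈p′ =
    does-⇔ (mk⇔ (InQ-SameAbove {P = P} {σs = σs} p≈p′) (InQ-SameAbove {P = P} {σs = σs} (λ i ℓ<i → sym (p≈p′ i ℓ<i))))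
      (decQ P σs ℓ p y) (decQ P σs ℓ p′ y)

  members-SameAbove : ∀ {P σs ℓ p p′} → SameAbove ℓ p p′ → members P σs ℓ p ≡ members P σs ℓ p′
  members-SameAbove p≈p′ = filterᵇ-cong (allFin n) (λ y → inQ-SameAbove y p≈p′)

  members-nonempty : ∀ {P σs ℓ p y} → InQ P σs ℓ p y → Σ[ y₀ ∈ U ] Σ[ ys ∈ List U ] members P σs ℓ p ≡ y₀ ∷ ys
  members-nonempty {P} {σs} {ℓ} {p} {y} q =
    ∈⇒nonempty (members P σs ℓ p)
      (∈-filter⁺ (T? ∘ inQ P σs ℓ p) (∈-allFin y) (Equivalence.from T-≡ (dec-true (decQ P σs ℓ p y) q)))

  agreeAbove≡true⇔ : (ℓ : Fin k) (p c : Config) → agreeAbove ℓ p c ≡ true ⇔ SameAbove ℓ c p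
  agreeAbove≡true⇔ ℓ p c = mk⇔
    (λ e i ℓ<i → pointwise⇒ i ℓ<i (AP.tabulate⁻ (Equivalence.to (allᵇ≡true⇔All above⇒agree (allFin k)) e) i))
    (λ c≈p → Equivalence.from (allᵇ≡true⇔All above⇒agree (allFin k)) (AP.tabulate⁺ (λ i → pointwise⇐ i (c≈p i))))
    where
    above⇒agree : Fin k → Bool
    above⇒agree i = not (toℕ ℓ <ᵇ toℕ i) ∨ does (c i Fin.≟ p i)
    pointwise⇒ : ∀ i → toℕ ℓ < toℕ i → above⇒agree i ≡ true → c i ≡ p i
    pointwise⇒ i ℓ<i with toℕ ℓ <ᵇ toℕ i | ℕ.<ᵇ-reflects-< (toℕ ℓ) (toℕ i) | c i Fin.≟ p i
    ... | _     | ofⁿ ℓ≮i | _         = contradiction ℓ<i ℓ≮i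
    ... | true  | ofʸ _   | yes ci≡pi = λ _ → ci≡pi
    ... | true  | ofʸ _   | no _      = λ ()
    pointwise⇐ : ∀ i → (toℕ ℓ < toℕ i → c i ≡ p i) → above⇒agree i ≡ true
    pointwise⇐ i agree with toℕ ℓ <ᵇ toℕ i | ℕ.<ᵇ-reflects-< (toℕ ℓ) (toℕ i)
    ... | false | _      = refl
    ... | true  | ofʸ ℓ<i = dec-true (c i Fin.≟ p i) (agree ℓ<i)

  agreeAbove⇒SameAbove : ∀ ℓ p c → agreeAbove ℓ p c ≡ true → SameAbove ℓ c p
  agreeAbove⇒SameAbove ℓ p c = Equivalence.to (agreeAbove≡true⇔ ℓ p c)

  agreeAbove-SameAbove : (ℓ : Fin k) (p : Config) {c c′ : Config} →
    SameAbove ℓ c c′ → agreeAbove ℓ p c ≡ agreeAbove ℓ p c′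
  agreeAbove-SameAbove ℓ p {c} {c′} c≈c′ = ⇔→≡ (mk⇔
    (λ e → Equivalence.from (agreeAbove≡true⇔ ℓ p c′)
             (λ i ℓ<i → trans (sym (c≈c′ i ℓ<i)) (agreeAbove⇒SameAbove ℓ p c e i ℓ<i)))
    (λ e → Equivalence.from (agreeAbove≡true⇔ ℓ p c)
             (λ i ℓ<i → trans (c≈c′ i ℓ<i) (agreeAbove⇒SameAbove ℓ p c′ e i ℓ<i))))

  record LevelSplit (ℓ : Fin k) : Set where
    field
      above below : List (Fin k)
      levelsDown≡ : levelsDown ≡ above ++ ℓ ∷ below
      above-higher : All (λ i → toℕ ℓ < toℕ i) above
      below-lower : All (λ i → toℕ i < toℕ ℓ) below

  levelsDown-split : (ℓ : Fin k) → LevelSplit ℓ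
  levelsDown-split ℓ with allFin-split ℓ
  ... | below , above , allFin≡ , below< , above> = record
    { above = reverse above
    ; below = reverse below
    ; levelsDown≡ = begin
        reverse (allFin k)                    ≡⟨ cong reverse allFin≡ ⟩
        reverse (below ++ ℓ ∷ above)          ≡⟨ LP.reverse-++ below (ℓ ∷ above) ⟩
        reverse (ℓ ∷ above) ++ reverse below  ≡⟨ cong (_++ reverse below) (LP.unfold-reverse ℓ above) ⟩
        (reverse above ∷ʳ ℓ) ++ reverse below ≡⟨ LP.++-assoc (reverse above) (ℓ ∷ []) (reverse below) ⟩
        reverse above ++ ℓ ∷ reverse below    ∎
    ; above-higher = All-reverse above>
    ; below-lower = All-reverse below<
    }
    where open ≡-Reasoning

  module Round (P : Pattern) (σs : List U) (ℓt : Fin (suc k)) where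

    State : Set
    State = Bool × Config

    step : State → Fin k → Dist State
    step = levelStep P σs ℓt

    move : Bool → Config → Fin k → Dist State
    move b c i = mapD (λ y → b , update c i y) (uniformD (members P σs i c) (c i))

    stays : State → Fin k → Bool
    stays (fl , c) i = not (fl ∨ (toℕ i <ᵇ toℕ ℓt)) ∧ inQ P σs i c (c i)

    step-cases : ∀ fl c i →
      (stays (fl , c) i ≡ true × step (fl , c) i ≡ returnD (fl , c))
      ⊎ (stays (fl , c) i ≡ false × Σ[ b ∈ Bool ] step (fl , c) i ≡ move b c i)
    step-cases fl c i with fl ∨ (toℕ i <ᵇ toℕ ℓt) | inQ P σs i c (c i)
    ... | true  | _     = inj₂ (refl , fl , refl)
    ... | false | true  = inj₁ (refl , refl)
    ... | false | false = inj₂ (refl , true , refl)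

    step-unforced : ∀ c i → (toℕ i <ᵇ toℕ ℓt) ≡ false →
      step (false , c) i ≡ (if inQ P σs i c (c i) then returnD (false , c) else move true c i)
    step-unforced c i unforced =
      cong (λ b → if b then move false c i else (if inQ P σs i c (c i) then returnD (false , c) else move true c i))
        unforced

    𝔼-move-const : (g : State → ℚ) (r : ℚ) → ∀ b c i → (∀ y → g (b , update c i y) ≡ r) → 𝔼 (move b c i) g ≡ r
    𝔼-move-const g r b c i eq =
      trans (𝔼-mapD (λ y → b , update c i y) (uniformD (members P σs i c) (c i)) g)
        (𝔼-uniformD-const (members P σs i c) (c i) _ r eq)

    𝔼-step-invariant : (g : State → ℚ) → ∀ fl c i →
      (∀ b y → g (b , update c i y) ≡ g (fl , c)) → 𝔼 (step (fl , c) i) g ≡ g (fl , c)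
    𝔼-step-invariant g fl c i invariant with step-cases fl c i
    ... | inj₁ (_ , step≡) = trans (cong (λ d → 𝔼 d g) step≡) (𝔼-return (fl , c) g)
    ... | inj₂ (_ , b , step≡) = trans (cong (λ d → 𝔼 d g) step≡) (𝔼-move-const g (g (fl , c)) b c i (invariant b))

    𝔼-foldD-invariant : (g : State → ℚ) {R : Fin k → Set} →
      (∀ {i} → R i → ∀ fl c b y → g (b , update c i y) ≡ g (fl , c)) → ∀ {is} → All R is → ∀ s → 𝔼 (foldD step s is) g ≡ g s
    𝔼-foldD-invariant g invariant []         s        = 𝔼-return s g
    𝔼-foldD-invariant g invariant {i ∷ is} (ri ∷ ris) (fl , c) = begin
      𝔼 (foldD step (fl , c) (i ∷ is)) g                 ≡⟨ 𝔼-foldD-∷ step (fl , c) i is g ⟩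
      𝔼 (step (fl , c) i) (λ s → 𝔼 (foldD step s is) g) ≡⟨ 𝔼-cong (step (fl , c) i) (𝔼-foldD-invariant g invariant ris) ⟩
      𝔼 (step (fl , c) i) g                              ≡⟨ 𝔼-step-invariant g fl c i (λ b y → invariant ri fl c b y) ⟩
      g (fl , c)                                         ∎
      where open ≡-Reasoning

    𝔼-foldD-flagged : (h : State → ℚ) → (∀ c → h (true , c) ≡ 0ℚ) → ∀ is c → 𝔼 (foldD step (true , c) is) h ≡ 0ℚ
    𝔼-foldD-flagged h h≡0 []       c = trans (𝔼-return (true , c) h) (h≡0 c)
    𝔼-foldD-flagged h h≡0 (i ∷ is) c = trans (𝔼-foldD-∷ step (true , c) i is h)
      (𝔼-move-const (λ s → 𝔼 (foldD step s is) h) 0ℚ true c i (λ y → 𝔼-foldD-flagged h h≡0 is (update c i y)))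

    allStay : Config → List (Fin k) → Bool
    allStay c = allᵇ (λ i → inQ P σs i c (c i))

    𝔼-foldD-unforced : (h : State → ℚ) → (∀ c → h (true , c) ≡ 0ℚ) →
      ∀ {is} → All (λ i → (toℕ i <ᵇ toℕ ℓt) ≡ false) is →
      ∀ c → 𝔼 (foldD step (false , c) is) h ≡ 𝟙 (allStay c is) * h (false , c)
    𝔼-foldD-unforced h h≡0 [] c = trans (𝔼-return (false , c) h) (sym (*-identityˡ (h (false , c))))
    𝔼-foldD-unforced h h≡0 {i ∷ is} (unforced ∷ unforceds) c = begin
      𝔼 (foldD step (false , c) (i ∷ is)) h
        ≡⟨ 𝔼-foldD-∷ step (false , c) i is h ⟩
      𝔼 (step (false , c) i) rest
        ≡⟨ cong (λ d → 𝔼 d rest) (step-unforced c i unforced) ⟩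
      𝔼 (if inQ P σs i c (c i) then returnD (false , c) else move true c i) rest
        ≡⟨ decide (inQ P σs i c (c i)) ⟩
      𝟙 (inQ P σs i c (c i) ∧ allStay c is) * h (false , c) ∎
      where
      open ≡-Reasoning
      rest : State → ℚ
      rest s = 𝔼 (foldD step s is) h
      decide : ∀ q → 𝔼 (if q then returnD (false , c) else move true c i) rest ≡ 𝟙 (q ∧ allStay c is) * h (false , c)
      decide true  = trans (𝔼-return (false , c) rest) (𝔼-foldD-unforced h h≡0 unforceds c)
      decide false = trans (𝔼-move-const rest 0ℚ true c i (λ y → 𝔼-foldD-flagged h h≡0 is (update c i y)))
                           (sym (*-zeroˡ (h (false , c))))

    afterRound : Dist Config → Dist Config
    afterRound d = bindD d (λ c → mapD proj₂ (foldD step (false , c) levelsDown))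

    Pr-afterRound : ∀ d (E : Config → Bool) →
      Pr (afterRound d) E ≡ 𝔼 d (λ c → 𝔼 (foldD step (false , c) levelsDown) (λ s → 𝟙 (E (proj₂ s))))
    Pr-afterRound d E = begin
      Pr (afterRound d) E
        ≡⟨ Pr≡𝔼 (afterRound d) E ⟩
      𝔼 (afterRound d) (λ c → 𝟙 (E c))
        ≡⟨ 𝔼-bindD d (λ c → mapD proj₂ (foldD step (false , c) levelsDown)) (λ c → 𝟙 (E c)) ⟩
      𝔼 d (λ c → 𝔼 (mapD proj₂ (foldD step (false , c) levelsDown)) (λ c → 𝟙 (E c)))
        ≡⟨ 𝔼-cong d (λ c → 𝔼-mapD proj₂ (foldD step (false , c) levelsDown) (λ c → 𝟙 (E c))) ⟩
      𝔼 d (λ c → 𝔼 (foldD step (false , c) levelsDown) (λ s → 𝟙 (E (proj₂ s)))) ∎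
      where open ≡-Reasoning

    module AtLevel (ℓ : Fin k) (p : Config) (x : U) {y₀ : U} {ys : List U}
                   (members≡ : members P σs ℓ p ≡ y₀ ∷ ys) where

      Q : List U
      Q = members P σs ℓ p

      -- |Q| and 1/|Q|, the latter in the form produced by uniformD.
      m w : ℚ
      m = ℕ→ℚ (suc (length ys))
      w = + 1 / suc (length ys)

      agrees hitsX staysAgreeing bias : State → ℚ
      agrees (_ , c) = 𝟙 (agreeAbove ℓ p c)
      hitsX (_ , c) = 𝟙 (agreeAboveAt ℓ p x c)
      staysAgreeing s = 𝟙 (agreeAbove ℓ p (proj₂ s) ∧ stays s ℓ)
      bias s = staysAgreeing s * (hitsX s - w)

      agreeAbove-update : ∀ c {i} y → toℕ i ≤ toℕ ℓ → agreeAbove ℓ p (update c i y) ≡ agreeAbove ℓ p c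
      agreeAbove-update c y i≤ℓ = agreeAbove-SameAbove ℓ p (update-SameAbove c y i≤ℓ)

      hitsX-below : ∀ {i} → toℕ i < toℕ ℓ → ∀ fl c b y → hitsX (b , update c i y) ≡ hitsX (fl , c)
      hitsX-below i<ℓ fl c b y = cong₂ (λ a e → 𝟙 (a ∧ e))
        (agreeAbove-update c y (ℕ.<⇒≤ i<ℓ))
        (cong (λ z → does (z Fin.≟ x)) (update-other c _ y (λ ℓ≡i → ℕ.<⇒≢ i<ℓ (cong toℕ (sym ℓ≡i)))))

      agrees-below : ∀ {i} → toℕ i ≤ toℕ ℓ → ∀ fl c b y → agrees (b , update c i y) ≡ agrees (fl , c)
      agrees-below i≤ℓ fl c b y = cong 𝟙 (agreeAbove-update c y i≤ℓ)

      𝔼-step-agrees : ∀ s → 𝔼 (step s ℓ) agrees ≡ agrees s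
      𝔼-step-agrees (fl , c) = 𝔼-step-invariant agrees fl c ℓ (agrees-below ℕ.≤-refl fl c)

      𝔼-step-disagreeing : ∀ fl c → agreeAbove ℓ p c ≡ false → 𝔼 (step (fl , c) ℓ) hitsX ≡ 0ℚ
      𝔼-step-disagreeing fl c disagree = trans
        (𝔼-step-invariant hitsX fl c ℓ (λ b y →
          trans (hitsX-disagree {update c ℓ y} {b} (trans (agreeAbove-update c y ℕ.≤-refl) disagree))
                (sym (hitsX-disagree {c} {fl} disagree))))
        (hitsX-disagree {c} {fl} disagree)
        where
        hitsX-disagree : ∀ {c′ b} → agreeAbove ℓ p c′ ≡ false → hitsX (b , c′) ≡ 0ℚ
        hitsX-disagree {c′} e = cong (λ a → 𝟙 (a ∧ does (c′ ℓ Fin.≟ x))) e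

      𝔼-move-hitsX : ∀ b c → agreeAbove ℓ p c ≡ true → 𝔼 (move b c ℓ) hitsX ≡ w * 𝟙 (inQ P σs ℓ p x)
      𝔼-move-hitsX b c agree = begin
        𝔼 (move b c ℓ) hitsX
          ≡⟨ 𝔼-mapD (λ y → b , update c ℓ y) (uniformD (members P σs ℓ c) (c ℓ)) hitsX ⟩
        𝔼 (uniformD (members P σs ℓ c) (c ℓ)) hit
          ≡⟨ cong (λ M → 𝔼 (uniformD M (c ℓ)) hit) (trans (members-SameAbove c≈p) members≡) ⟩
        𝔼 (uniformD (y₀ ∷ ys) (c ℓ)) hit
          ≡⟨ 𝔼-uniformD y₀ ys (c ℓ) hit ⟩
        w * ∑ (y₀ ∷ ys) hit
          ≡⟨ cong (λ M → w * ∑ M hit) members≡ ⟨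
        w * ∑ (Q) hit
          ≡⟨ cong (w *_) (𝔼-cong (map (1ℚ ,_) (Q)) hit≡δ) ⟩
        w * ∑ (Q) (λ y → 𝟙 (does (x Fin.≟ y)))
          ≡⟨ cong (w *_) (∑-members-δ (inQ P σs ℓ p) x) ⟩
        w * 𝟙 (inQ P σs ℓ p x) ∎
        where
        open ≡-Reasoning
        c≈p : SameAbove ℓ c p
        c≈p = agreeAbove⇒SameAbove ℓ p c agree
        hit : U → ℚ
        hit y = hitsX (b , update c ℓ y)
        hit≡δ : ∀ y → hit y ≡ 𝟙 (does (x Fin.≟ y))
        hit≡δ y = cong₂ (λ a e → 𝟙 (a ∧ e))
          (trans (agreeAbove-update c y ℕ.≤-refl) agree)
          (trans (cong (λ z → does (z Fin.≟ x)) (update-self c ℓ y)) (does-⇔ (mk⇔ sym sym) (y Fin.≟ x) (x Fin.≟ y)))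

      𝔼-step-hitsX : inQ P σs ℓ p x ≡ true → ∀ s → 𝔼 (step s ℓ) hitsX ≡ w * agrees s + bias s
      𝔼-step-hitsX x∈Q (fl , c) with agreeAbove ℓ p c in agree | step-cases fl c ℓ
      ... | false | _ = trans (𝔼-step-disagreeing fl c agree) (absent w)
        where
        absent : ∀ (w : ℚ) → 0ℚ ≡ w * 0ℚ + 0ℚ * (0ℚ - w)
        absent = solve-∀ ℚ-ring
      ... | true | inj₁ (stays≡ , step≡) = begin
        𝔼 (step (fl , c) ℓ) hitsX              ≡⟨ cong (λ d → 𝔼 d hitsX) step≡ ⟩
        𝔼 (returnD (fl , c)) hitsX             ≡⟨ 𝔼-return (fl , c) hitsX ⟩
        𝟙 (agreeAbove ℓ p c ∧ hit)             ≡⟨ cong (λ a → 𝟙 (a ∧ hit)) agree ⟩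
        𝟙 hit                                  ≡⟨ staying w (𝟙 hit) ⟩
        w * 1ℚ + 1ℚ * (𝟙 hit - w)              ≡⟨ cong (λ b → w * 1ℚ + 𝟙 b * (𝟙 hit - w)) stays≡ ⟨
        w * 1ℚ + 𝟙 (stays (fl , c) ℓ) * (𝟙 hit - w) ∎
        where
        open ≡-Reasoning
        hit : Bool
        hit = does (c ℓ Fin.≟ x)
        staying : ∀ (w h : ℚ) → h ≡ w * 1ℚ + 1ℚ * (h - w)
        staying = solve-∀ ℚ-ring
      ... | true | inj₂ (stays≡ , b , step≡) = begin
        𝔼 (step (fl , c) ℓ) hitsX              ≡⟨ cong (λ d → 𝔼 d hitsX) step≡ ⟩
        𝔼 (move b c ℓ) hitsX                   ≡⟨ 𝔼-move-hitsX b c agree ⟩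
        w * 𝟙 (inQ P σs ℓ p x)                 ≡⟨ cong (λ q → w * 𝟙 q) x∈Q ⟩
        w * 1ℚ                                 ≡⟨ moving w (𝟙 hit) ⟩
        w * 1ℚ + 0ℚ * (𝟙 hit - w)              ≡⟨ cong (λ b → w * 1ℚ + 𝟙 b * (𝟙 hit - w)) stays≡ ⟨
        w * 1ℚ + 𝟙 (stays (fl , c) ℓ) * (𝟙 hit - w) ∎
        where
        open ≡-Reasoning
        hit : Bool
        hit = does (c ℓ Fin.≟ x)
        moving : ∀ (w h : ℚ) → w * 1ℚ ≡ w * 1ℚ + 0ℚ * (h - w)
        moving = solve-∀ ℚ-ring

      𝔼-step-hitsX-∉ : inQ P σs ℓ p x ≡ false → ∀ s → 𝔼 (step s ℓ) hitsX ≡ 0ℚ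
      𝔼-step-hitsX-∉ x∉Q (fl , c) with agreeAbove ℓ p c in agree | step-cases fl c ℓ
      ... | false | _ = 𝔼-step-disagreeing fl c agree
      ... | true | inj₁ (stays≡ , step≡) = begin
        𝔼 (step (fl , c) ℓ) hitsX            ≡⟨ cong (λ d → 𝔼 d hitsX) step≡ ⟩
        𝔼 (returnD (fl , c)) hitsX           ≡⟨ 𝔼-return (fl , c) hitsX ⟩
        𝟙 (agreeAbove ℓ p c ∧ does (c ℓ Fin.≟ x)) ≡⟨ cong₂ (λ a e → 𝟙 (a ∧ e)) agree (dec-false (c ℓ Fin.≟ x) cℓ≢x) ⟩
        0ℚ                                   ∎
        where
        open ≡-Reasoning
        cℓ∈Q : inQ P σs ℓ p (c ℓ) ≡ true
        cℓ∈Q = trans (inQ-SameAbove (c ℓ) (λ i ℓ<i → sym (agreeAbove⇒SameAbove ℓ p c agree i ℓ<i)))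
                     (∧-conicalʳ _ _ stays≡)
        cℓ≢x : c ℓ ≢ x
        cℓ≢x cℓ≡x = case trans (sym x∉Q) (subst (λ z → inQ P σs ℓ p z ≡ true) cℓ≡x cℓ∈Q) of λ ()
      ... | true | inj₂ (_ , b , step≡) = begin
        𝔼 (step (fl , c) ℓ) hitsX            ≡⟨ cong (λ d → 𝔼 d hitsX) step≡ ⟩
        𝔼 (move b c ℓ) hitsX                 ≡⟨ 𝔼-move-hitsX b c agree ⟩
        w * 𝟙 (inQ P σs ℓ p x)               ≡⟨ cong (λ q → w * 𝟙 q) x∉Q ⟩
        w * 0ℚ                               ≡⟨ *-zeroʳ w ⟩
        0ℚ                                   ∎
        where open ≡-Reasoning

      open LevelSplit (levelsDown-split ℓ)

      𝔼-round-split : (g : State → ℚ) → (∀ {i} → toℕ i < toℕ ℓ → ∀ fl c b y → g (b , update c i y) ≡ g (fl , c)) →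
        ∀ s → 𝔼 (foldD step s levelsDown) g ≡ 𝔼 (foldD step s above) (λ s′ → 𝔼 (step s′ ℓ) g)
      𝔼-round-split g invariant s = begin
        𝔼 (foldD step s levelsDown) g
          ≡⟨ cong (λ is → 𝔼 (foldD step s is) g) levelsDown≡ ⟩
        𝔼 (foldD step s (above ++ ℓ ∷ below)) g
          ≡⟨ 𝔼-foldD-++ step s above (ℓ ∷ below) g ⟩
        𝔼 (foldD step s above) (λ s′ → 𝔼 (foldD step s′ (ℓ ∷ below)) g)
          ≡⟨ 𝔼-cong (foldD step s above) (λ s′ → trans (𝔼-foldD-∷ step s′ ℓ below g)
               (𝔼-cong (step s′ ℓ) (𝔼-foldD-invariant g invariant below-lower))) ⟩
        𝔼 (foldD step s above) (λ s′ → 𝔼 (step s′ ℓ) g) ∎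
        where open ≡-Reasoning

      𝔼-round-agrees : ∀ s → 𝔼 (foldD step s levelsDown) agrees ≡ 𝔼 (foldD step s above) agrees
      𝔼-round-agrees s = trans (𝔼-round-split agrees (λ i<ℓ → agrees-below (ℕ.<⇒≤ i<ℓ)) s)
                               (𝔼-cong (foldD step s above) 𝔼-step-agrees)

      𝔼-round-hitsX : inQ P σs ℓ p x ≡ true → ∀ s →
        𝔼 (foldD step s levelsDown) hitsX ≡ w * 𝔼 (foldD step s levelsDown) agrees + 𝔼 (foldD step s above) bias
      𝔼-round-hitsX x∈Q s = begin
        𝔼 (foldD step s levelsDown) hitsX                     ≡⟨ 𝔼-round-split hitsX hitsX-below s ⟩
        𝔼 D (λ s′ → 𝔼 (step s′ ℓ) hitsX)                      ≡⟨ 𝔼-cong D (𝔼-step-hitsX x∈Q) ⟩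
        𝔼 D (λ s′ → w * agrees s′ + bias s′)                   ≡⟨ 𝔼-+ D (λ s′ → w * agrees s′) bias ⟩
        𝔼 D (λ s′ → w * agrees s′) + 𝔼 D bias                 ≡⟨ cong (_+ 𝔼 D bias) (𝔼-*ˡ D w agrees) ⟩
        w * 𝔼 D agrees + 𝔼 D bias                             ≡⟨ cong (λ e → w * e + 𝔼 D bias) (𝔼-round-agrees s) ⟨
        w * 𝔼 (foldD step s levelsDown) agrees + 𝔼 D bias     ∎
        where
        open ≡-Reasoning
        D : Dist State
        D = foldD step s above

      𝔼-round-hitsX-∉ : inQ P σs ℓ p x ≡ false → ∀ s → 𝔼 (foldD step s levelsDown) hitsX ≡ 0ℚ
      𝔼-round-hitsX-∉ x∉Q s = trans (𝔼-round-split hitsX hitsX-below s)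
        (trans (𝔼-cong (foldD step s above) (𝔼-step-hitsX-∉ x∉Q)) (𝔼-zero (foldD step s above)))

      bias-vanishes : ∀ fl c → (fl ∨ (toℕ ℓ <ᵇ toℕ ℓt)) ≡ true → bias (fl , c) ≡ 0ℚ
      bias-vanishes fl c forced = begin
        𝟙 (agreeAbove ℓ p c ∧ (not (fl ∨ (toℕ ℓ <ᵇ toℕ ℓt)) ∧ inQ P σs ℓ c (c ℓ))) * h
          ≡⟨ cong (λ f → 𝟙 (agreeAbove ℓ p c ∧ (not f ∧ inQ P σs ℓ c (c ℓ))) * h) forced ⟩
        𝟙 (agreeAbove ℓ p c ∧ false) * h
          ≡⟨ cong (λ a → 𝟙 a * h) (∧-zeroʳ (agreeAbove ℓ p c)) ⟩
        0ℚ * h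
          ≡⟨ *-zeroˡ h ⟩
        0ℚ ∎
        where
        open ≡-Reasoning
        h : ℚ
        h = hitsX (fl , c) - w

      𝔼-above-bias-unforced : toℕ ℓt ≤ toℕ ℓ → ∀ c →
        𝔼 (foldD step (false , c) above) bias ≡ 𝟙 (allStay p above) * bias (false , c)
      𝔼-above-bias-unforced ℓt≤ℓ c =
        trans (𝔼-foldD-unforced bias (λ c → bias-vanishes true c refl) (All.map above-unforced above-higher) c)
              (allStay-swap c)
        where
        above-unforced : ∀ {i} → toℕ ℓ < toℕ i → (toℕ i <ᵇ toℕ ℓt) ≡ false
        above-unforced ℓ<i = <ᵇ≡false (ℕ.≤-trans ℓt≤ℓ (ℕ.<⇒≤ ℓ<i))
        allStay-swap : ∀ c → 𝟙 (allStay c above) * bias (false , c) ≡ 𝟙 (allStay p above) * bias (false , c)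
        allStay-swap c with agreeAbove ℓ p c in agree
        ... | true  = cong (λ a → 𝟙 a * _) (allᵇ-cong (All.map stays-as-p above-higher))
          where
          c≈p : SameAbove ℓ c p
          c≈p = agreeAbove⇒SameAbove ℓ p c agree
          stays-as-p : ∀ {i} → toℕ ℓ < toℕ i → inQ P σs i c (c i) ≡ inQ P σs i p (p i)
          stays-as-p {i} ℓ<i = trans (cong (inQ P σs i c) (c≈p i ℓ<i))
            (inQ-SameAbove (p i) (λ j i<j → c≈p j (ℕ.<-trans ℓ<i i<j)))
        ... | false = zero-either (𝟙 (allStay c above)) (𝟙 (allStay p above)) w
          where
          zero-either : ∀ (a b w : ℚ) → a * (0ℚ * (0ℚ - w)) ≡ b * (0ℚ * (0ℚ - w))
          zero-either = solve-∀ ℚ-ring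

      bias-unforced : toℕ ℓt ≤ toℕ ℓ → inQ P σs ℓ p x ≡ true → ∀ c →
        bias (false , c) ≡ 𝟙 (agreeAboveAt ℓ p x c) - w * ∑ (Q) (λ y → 𝟙 (agreeAboveAt ℓ p y c))
      bias-unforced ℓt≤ℓ x∈Q c with agreeAbove ℓ p c in agree
      ... | false = trans (𝟙-⇒-*-distrib w false false (λ ()))
        (cong (λ z → 0ℚ - w * z) (sym (𝔼-zero (map (1ℚ ,_) (Q)))))
      ... | true = begin
        𝟙 (not (toℕ ℓ <ᵇ toℕ ℓt) ∧ inQ P σs ℓ c (c ℓ)) * (𝟙 hit - w)
          ≡⟨ cong₂ (λ b q → 𝟙 (not b ∧ q) * (𝟙 hit - w)) (<ᵇ≡false ℓt≤ℓ) (inQ-SameAbove (c ℓ) c≈p) ⟩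
        𝟙 (inQ P σs ℓ p (c ℓ)) * (𝟙 hit - w)
          ≡⟨ 𝟙-⇒-*-distrib w (inQ P σs ℓ p (c ℓ)) hit hit⇒∈Q ⟩
        𝟙 hit - w * 𝟙 (inQ P σs ℓ p (c ℓ))
          ≡⟨ cong (λ e → 𝟙 hit - w * e) (∑-members-δ (inQ P σs ℓ p) (c ℓ)) ⟨
        𝟙 hit - w * ∑ (Q) (λ y → 𝟙 (does (c ℓ Fin.≟ y))) ∎
        where
        open ≡-Reasoning
        hit : Bool
        hit = does (c ℓ Fin.≟ x)
        c≈p : SameAbove ℓ c p
        c≈p = agreeAbove⇒SameAbove ℓ p c agree
        hit⇒∈Q : hit ≡ true → inQ P σs ℓ p (c ℓ) ≡ true
        hit⇒∈Q h with c ℓ Fin.≟ x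
        ... | yes cℓ≡x = trans (cong (inQ P σs ℓ p) cℓ≡x) x∈Q

      roundBias : Config → ℚ
      roundBias c = 𝔼 (foldD step (false , c) above) bias

      Pr-afterRound-∉ : inQ P σs ℓ p x ≡ false → ∀ d → Pr (afterRound d) (agreeAboveAt ℓ p x) ≡ 0ℚ
      Pr-afterRound-∉ x∉Q d = trans (Pr-afterRound d (agreeAboveAt ℓ p x))
        (trans (𝔼-cong d (λ c → 𝔼-round-hitsX-∉ x∉Q (false , c))) (𝔼-zero d))

      Pr-afterRound-∈ : inQ P σs ℓ p x ≡ true → ∀ d →
        Pr (afterRound d) (agreeAboveAt ℓ p x) ≡ w * Pr (afterRound d) (agreeAbove ℓ p) + 𝔼 d roundBias
      Pr-afterRound-∈ x∈Q d = begin
        Pr (afterRound d) (agreeAboveAt ℓ p x)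
          ≡⟨ Pr-afterRound d (agreeAboveAt ℓ p x) ⟩
        𝔼 d (λ c → 𝔼 (roundFrom c) hitsX)
          ≡⟨ 𝔼-cong d (λ c → 𝔼-round-hitsX x∈Q (false , c)) ⟩
        𝔼 d (λ c → w * 𝔼 (roundFrom c) agrees + roundBias c)
          ≡⟨ 𝔼-+ d (λ c → w * 𝔼 (roundFrom c) agrees) roundBias ⟩
        𝔼 d (λ c → w * 𝔼 (roundFrom c) agrees) + 𝔼 d roundBias
          ≡⟨ cong (_+ 𝔼 d roundBias) (𝔼-*ˡ d w (λ c → 𝔼 (roundFrom c) agrees)) ⟩
        w * 𝔼 d (λ c → 𝔼 (roundFrom c) agrees) + 𝔼 d roundBias
          ≡⟨ cong (λ e → w * e + 𝔼 d roundBias) (Pr-afterRound d (agreeAbove ℓ p)) ⟨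
        w * Pr (afterRound d) (agreeAbove ℓ p) + 𝔼 d roundBias ∎
        where
        open ≡-Reasoning
        roundFrom : Config → Dist State
        roundFrom c = foldD step (false , c) levelsDown

      𝔼-roundBias-forced : (toℕ ℓ <ᵇ toℕ ℓt) ≡ true → ∀ d → 𝔼 d roundBias ≡ 0ℚ
      𝔼-roundBias-forced forced d = trans (𝔼-cong d roundBias≡0) (𝔼-zero d)
        where
        roundBias≡0 : ∀ c → roundBias c ≡ 0ℚ
        roundBias≡0 c = trans
          (𝔼-cong (foldD step (false , c) above)
            (λ (fl , c′) → bias-vanishes fl c′ (trans (cong (fl ∨_) forced) (∨-zeroʳ fl))))
          (𝔼-zero (foldD step (false , c) above))

      𝔼-bias-unforced : toℕ ℓt ≤ toℕ ℓ → inQ P σs ℓ p x ≡ true → ∀ d →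
        𝔼 d (λ c → bias (false , c)) ≡ Pr d (agreeAboveAt ℓ p x) - w * ∑ Q (λ y → Pr d (agreeAboveAt ℓ p y))
      𝔼-bias-unforced ℓt≤ℓ x∈Q d = begin
        𝔼 d (λ c → bias (false , c))
          ≡⟨ 𝔼-cong d (bias-unforced ℓt≤ℓ x∈Q) ⟩
        𝔼 d (λ c → hit x c - w * ∑ Q (λ y → hit y c))
          ≡⟨ 𝔼-- d (hit x) (λ c → w * ∑ Q (λ y → hit y c)) ⟩
        𝔼 d (hit x) - 𝔼 d (λ c → w * ∑ Q (λ y → hit y c))
          ≡⟨ cong (𝔼 d (hit x) -_) (𝔼-*ˡ d w (λ c → ∑ Q (λ y → hit y c))) ⟩
        𝔼 d (hit x) - w * 𝔼 d (λ c → ∑ Q (λ y → hit y c))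
          ≡⟨ cong (λ e → 𝔼 d (hit x) - w * e) (𝔼-comm d (map (1ℚ ,_) Q) (λ c y → hit y c)) ⟩
        𝔼 d (hit x) - w * ∑ Q (λ y → 𝔼 d (hit y))
          ≡⟨ cong₂ (λ e f → e - w * f) (sym (Pr≡𝔼 d (agreeAboveAt ℓ p x)))
               (𝔼-cong (map (1ℚ ,_) Q) (λ y → sym (Pr≡𝔼 d (agreeAboveAt ℓ p y)))) ⟩
        Pr d (agreeAboveAt ℓ p x) - w * ∑ Q (λ y → Pr d (agreeAboveAt ℓ p y)) ∎
        where
        open ≡-Reasoning
        hit : U → Config → ℚ
        hit y c = 𝟙 (agreeAboveAt ℓ p y c)

      𝔼-roundBias-unforced : toℕ ℓt ≤ toℕ ℓ → inQ P σs ℓ p x ≡ true → ∀ d →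
        (∀ y → inQ P σs ℓ p y ≡ true → Pr d (agreeAboveAt ℓ p y) ≡ Pr d (agreeAboveAt ℓ p x)) → 𝔼 d roundBias ≡ 0ℚ
      𝔼-roundBias-unforced ℓt≤ℓ x∈Q d equal = begin
        𝔼 d roundBias
          ≡⟨ 𝔼-cong d (𝔼-above-bias-unforced ℓt≤ℓ) ⟩
        𝔼 d (λ c → K * bias (false , c))
          ≡⟨ 𝔼-*ˡ d K (λ c → bias (false , c)) ⟩
        K * 𝔼 d (λ c → bias (false , c))
          ≡⟨ cong (K *_) (𝔼-bias-unforced ℓt≤ℓ x∈Q d) ⟩
        K * (π - w * ∑ Q (λ y → Pr d (agreeAboveAt ℓ p y)))
          ≡⟨ cong (λ e → K * (π - w * e)) (∑-filterᵇ-cong (inQ P σs ℓ p) (allFin n) equal) ⟩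
        K * (π - w * ∑ Q (λ _ → π))
          ≡⟨ cong (λ e → K * (π - w * e)) (trans (∑-const Q π) (cong (λ M → π * ℕ→ℚ (length M)) members≡)) ⟩
        K * (π - w * (π * m))
          ≡⟨ cong (λ e → K * (π - e)) (1/suc-cancel (length ys) π) ⟩
        K * (π - π)
          ≡⟨ cong (K *_) (+-inverseʳ π) ⟩
        K * 0ℚ
          ≡⟨ *-zeroʳ K ⟩
        0ℚ ∎
        where
        open ≡-Reasoning
        K π : ℚ
        K = 𝟙 (allStay p above)
        π = Pr d (agreeAboveAt ℓ p x)

      Pr-afterRound-uniform : inQ P σs ℓ p x ≡ true → ∀ d → 𝔼 d roundBias ≡ 0ℚ →
        Pr (afterRound d) (agreeAboveAt ℓ p x) * m ≡ Pr (afterRound d) (agreeAbove ℓ p)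
      Pr-afterRound-uniform x∈Q d unbiased = begin
        Pr (afterRound d) (agreeAboveAt ℓ p x) * m
          ≡⟨ cong (_* m) (Pr-afterRound-∈ x∈Q d) ⟩
        (w * Pr (afterRound d) (agreeAbove ℓ p) + 𝔼 d roundBias) * m
          ≡⟨ cong (λ e → (w * Pr (afterRound d) (agreeAbove ℓ p) + e) * m) unbiased ⟩
        (w * Pr (afterRound d) (agreeAbove ℓ p) + 0ℚ) * m
          ≡⟨ reorder w (Pr (afterRound d) (agreeAbove ℓ p)) m ⟩
        w * (Pr (afterRound d) (agreeAbove ℓ p) * m)
          ≡⟨ 1/suc-cancel (length ys) (Pr (afterRound d) (agreeAbove ℓ p)) ⟩
        Pr (afterRound d) (agreeAbove ℓ p) ∎
        where
        open ≡-Reasoning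
        reorder : ∀ (w π m : ℚ) → (w * π + 0ℚ) * m ≡ w * (π * m)
        reorder = solve-∀ ℚ-ring

  -- Induction over the rounds

  runFrom-snoc : ∀ hist xs y d →
    runFrom hist (xs ∷ʳ y) d ≡ bindD (runFrom hist xs d) (round ((hist ++ xs) ∷ʳ y) (proj₂ y))
  runFrom-snoc hist []       y d = cong (λ H → bindD d (round (H ∷ʳ y) (proj₂ y))) (sym (LP.++-identityʳ hist))
  runFrom-snoc hist (x ∷ xs) y d = trans (runFrom-snoc (hist ∷ʳ x) xs y (bindD d (round (hist ∷ʳ x) (proj₂ x))))
    (cong (λ H → bindD (runFrom (hist ∷ʳ x) xs (bindD d (round (hist ∷ʳ x) (proj₂ x)))) (round (H ∷ʳ y) (proj₂ y)))
      (LP.++-assoc hist (x ∷ []) xs))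

  run-snoc : ∀ c₀ h y →
    run c₀ (h ∷ʳ y) ≡ Round.afterRound (patternOf (h ∷ʳ y)) (requestsOf (h ∷ʳ y)) (proj₂ y) (run c₀ h)
  run-snoc c₀ h y = runFrom-snoc [] h y (returnD c₀)

  Uniform : Config → Input → Fin k → Set
  Uniform c₀ h ℓ = (p : Fin k → U) → ∃[ y ] InQ (patternOf h) (requestsOf h) ℓ p y → (x : U) →
    (InQ (patternOf h) (requestsOf h) ℓ p x →
      Pr (run c₀ h) (agreeAboveAt ℓ p x) * ℕ→ℚ (length (members (patternOf h) (requestsOf h) ℓ p))
      ≡ Pr (run c₀ h) (agreeAbove ℓ p))
    × (¬ InQ (patternOf h) (requestsOf h) ℓ p x → Pr (run c₀ h) (agreeAboveAt ℓ p x) ≡ 0ℚ)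

  Uniform⇒equal : ∀ {c₀ h ℓ p x y} → Uniform c₀ h ℓ →
    InQ (patternOf h) (requestsOf h) ℓ p x → InQ (patternOf h) (requestsOf h) ℓ p y →
    Pr (run c₀ h) (agreeAboveAt ℓ p y) ≡ Pr (run c₀ h) (agreeAboveAt ℓ p x)
  Uniform⇒equal {c₀} {h} {ℓ} {p} {x} {y} uniform x∈Q y∈Q with members-nonempty x∈Q
  ... | _ , ys , members≡ = *-cancelʳ-suc (length ys)
    (subst (λ M → π y * ℕ→ℚ (length M) ≡ π x * ℕ→ℚ (length M)) members≡
      (trans (proj₁ (uniform p (x , x∈Q) y) y∈Q) (sym (proj₁ (uniform p (x , x∈Q) x) x∈Q))))
    where
    π : U → ℚ
    π z = Pr (run c₀ h) (agreeAboveAt ℓ p z)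

  uniform-snoc : ∀ c₀ h y ℓ → (toℕ (proj₂ y) ≤ toℕ ℓ → Uniform c₀ h ℓ) → Uniform c₀ (h ∷ʳ y) ℓ
  uniform-snoc c₀ h y ℓ previous p (_ , y₁∈Q) x with members-nonempty y₁∈Q
  ... | _ , _ , members≡ = in-Q , outside-Q
    where
    P : Pattern
    P = patternOf (h ∷ʳ y)
    σs : List U
    σs = requestsOf (h ∷ʳ y)
    open Round P σs (proj₂ y)
    open AtLevel ℓ p x members≡
    d : Dist Config
    d = run c₀ h
    Pr-next : (E : Config → Bool) → Pr (run c₀ (h ∷ʳ y)) E ≡ Pr (afterRound d) E
    Pr-next E = cong (λ d′ → Pr d′ E) (run-snoc c₀ h y)
    outside-Q : ¬ InQ P σs ℓ p x → Pr (run c₀ (h ∷ʳ y)) (agreeAboveAt ℓ p x) ≡ 0ℚ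
    outside-Q x∉Q = trans (Pr-next (agreeAboveAt ℓ p x)) (Pr-afterRound-∉ (dec-false (decQ P σs ℓ p x) x∉Q) d)
    in-Q : InQ P σs ℓ p x →
      Pr (run c₀ (h ∷ʳ y)) (agreeAboveAt ℓ p x) * ℕ→ℚ (length Q) ≡ Pr (run c₀ (h ∷ʳ y)) (agreeAbove ℓ p)
    in-Q x∈Q = begin
      Pr (run c₀ (h ∷ʳ y)) (agreeAboveAt ℓ p x) * ℕ→ℚ (length Q)
        ≡⟨ cong₂ (λ π M → π * ℕ→ℚ (length M)) (Pr-next (agreeAboveAt ℓ p x)) members≡ ⟩
      Pr (afterRound d) (agreeAboveAt ℓ p x) * m
        ≡⟨ Pr-afterRound-uniform x∈Qᵇ d unbiased ⟩
      Pr (afterRound d) (agreeAbove ℓ p)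
        ≡⟨ Pr-next (agreeAbove ℓ p) ⟨
      Pr (run c₀ (h ∷ʳ y)) (agreeAbove ℓ p) ∎
      where
      open ≡-Reasoning
      x∈Qᵇ : inQ P σs ℓ p x ≡ true
      x∈Qᵇ = dec-true (decQ P σs ℓ p x) x∈Q
      unbiased : 𝔼 d roundBias ≡ 0ℚ
      unbiased with toℕ ℓ ℕ.<? toℕ (proj₂ y)
      ... | yes ℓ<ℓt = 𝔼-roundBias-forced (<ᵇ≡true ℓ<ℓt) d
      ... | no ℓ≮ℓt  = 𝔼-roundBias-unforced ℓt≤ℓ x∈Qᵇ d (λ z z∈Q →
              Uniform⇒equal {c₀ = c₀} {h = h} (previous ℓt≤ℓ)
                (InQ-snoc⁻ h y ℓt≤ℓ x∈Q) (InQ-snoc⁻ h y ℓt≤ℓ (does⇒ (decQ P σs ℓ p z) z∈Q)))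
        where
        ℓt≤ℓ : toℕ (proj₂ y) ≤ toℕ ℓ
        ℓt≤ℓ = ℕ.≮⇒≥ ℓ≮ℓt

  uniform : ∀ c₀ σ₁ {r} → Reverse r → ∀ ℓ → Uniform c₀ ((σ₁ , fromℕ k) ∷ r) ℓ
  uniform c₀ σ₁ []              ℓ = uniform-snoc c₀ [] (σ₁ , fromℕ k) ℓ
    (λ k≤ℓ → contradiction (subst (_≤ toℕ ℓ) (Fin.toℕ-fromℕ k) k≤ℓ) (ℕ.<⇒≱ (Fin.toℕ<n ℓ)))
  uniform c₀ σ₁ (r ∶ rs ∶ʳ z) ℓ = uniform-snoc c₀ ((σ₁ , fromℕ k) ∷ r) z ℓ (λ _ → uniform c₀ σ₁ rs ℓ)

lemma4 : (n k : ℕ) → let open Model n k in (decQ : DecQ) → let open Algorithm decQ in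
    (c₀ : Config) (σ₁ : U) (rest : Input) →
    Valid ((σ₁ , fromℕ k) ∷ rest) →
    (t : ℕ) → 1 ≤ t → t ≤ length ((σ₁ , fromℕ k) ∷ rest) →
    (ℓ : Fin k) (p : Fin k → U) →
    ∃[ y ] InQ (patternOf (take t ((σ₁ , fromℕ k) ∷ rest))) (requestsOf (take t ((σ₁ , fromℕ k) ∷ rest))) ℓ p y →
    (x : U) →
      (InQ (patternOf (take t ((σ₁ , fromℕ k) ∷ rest))) (requestsOf (take t ((σ₁ , fromℕ k) ∷ rest))) ℓ p x →
        Pr (run c₀ (take t ((σ₁ , fromℕ k) ∷ rest))) (agreeAboveAt ℓ p x)
          * (+ length (members (patternOf (take t ((σ₁ , fromℕ k) ∷ rest))) (requestsOf (take t ((σ₁ , fromℕ k) ∷ rest))) ℓ p) / 1)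
        ≡ Pr (run c₀ (take t ((σ₁ , fromℕ k) ∷ rest))) (agreeAbove ℓ p))
      × (¬ InQ (patternOf (take t ((σ₁ , fromℕ k) ∷ rest))) (requestsOf (take t ((σ₁ , fromℕ k) ∷ rest))) ℓ p x →
        Pr (run c₀ (take t ((σ₁ , fromℕ k) ∷ rest))) (agreeAboveAt ℓ p x) ≡ 0ℚ)
lemma4 n k decQ c₀ σ₁ rest _ (suc t) _ _ ℓ = uniform decQ c₀ σ₁ (reverseView (take t rest)) ℓ
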